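{- Let $m,n$ be nonnegative integers and $b$ a positive integer. If there is a perfect $(b,1)$-coloring of $D(m,n)$, then $b$ is divisible by $3$. Moreover, if $n=0$, then $b$ is divisible by $6$.
   Context: The Shrikhande graph is the Cayley graph on $\mathbb{Z}_4^2$ with connection set $\{01,03,10,30,11,33\}$. For nonnegative integers $m,n$, $D(m,n)$ is the Cartesian product of $m$ copies of the Shrikhande graph and $n$ copies of $K_4$ (vertex set $(\mathbb{Z}_4^2)^m\times\mathbb{Z}_4^n$; adjacent iff differing in exactly one coordinate by an adjacency of that factor). A perfect $(b,c)$-coloring is a surjective map onto colors $\{1,2\}$ such that every vertex of color $1$ has exactly $b$ neighbours of color $2$, every vertex of color $2$ has exactly $c$ neighbours of color $1$, and each vertex of color $i$ has a constant number of neighbours of its own color. -}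

module Defs where

open import Data.Nat using (ℕ; zero; suc; _+_)
open import Data.Fin using (Fin; zero; suc)
open import Data.Fin.Properties using () renaming (_≟_ to _≟F_)
open import Data.Bool using (Bool; true; false; _∧_; _∨_; if_then_else_)
open import Data.Vec using (Vec; []; _∷_)
open import Data.List using (List; []; _∷_; map; concatMap; allFin; length; filter)
open import Data.Product using (_×_; _,_; Σ; ∃; ∃-syntax)
open import Relation.Nullary.Decidable using (⌊_⌋)
open import Relation.Binary.PropositionalEquality using (_≡_)

suc4 : Fin 4 → Fin 4
suc4 zero = suc zero
suc4 (suc zero) = suc (suc zero)
suc4 (suc (suc zero)) = suc (suc (suc zero))
suc4 (suc (suc (suc zero))) = zero

pred4 : Fin 4 → Fin 4
pred4 zero = suc (suc (suc zero))
pred4 (suc zero) = zero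
pred4 (suc (suc zero)) = suc zero
pred4 (suc (suc (suc zero))) = suc (suc zero)

eqF : Fin 4 → Fin 4 → Bool
eqF a b = ⌊ a ≟F b ⌋

-- Shrikhande graph: Cayley graph on Z_4^2 with connection set
-- {01,03,10,30,11,33}: (a,b) ~ (c,d) iff (c-a,d-b) is in the set
shrikhandeAdj : Fin 4 × Fin 4 → Fin 4 × Fin 4 → Bool
shrikhandeAdj (a , b) (c , d) =
  (eqF c a ∧ eqF d (suc4 b)) ∨ (eqF c a ∧ eqF d (pred4 b)) ∨
  (eqF c (suc4 a) ∧ eqF d b) ∨ (eqF c (pred4 a) ∧ eqF d b) ∨
  (eqF c (suc4 a) ∧ eqF d (suc4 b)) ∨ (eqF c (pred4 a) ∧ eqF d (pred4 b))

k4Adj : Fin 4 → Fin 4 → Bool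
k4Adj a b = if eqF a b then false else true

eqS : Fin 4 × Fin 4 → Fin 4 × Fin 4 → Bool
eqS (a , b) (c , d) = eqF a c ∧ eqF b d

allEqV : {A : Set} → (A → A → Bool) → {k : ℕ} → Vec A k → Vec A k → Bool
allEqV eq [] [] = true
allEqV eq (u ∷ us) (v ∷ vs) = eq u v ∧ allEqV eq us vs

productAdj : {A : Set} → (A → A → Bool) → (A → A → Bool) → {k : ℕ} → Vec A k → Vec A k → Bool
productAdj adj eq [] [] = false
productAdj adj eq (x ∷ xs) (y ∷ ys) =
  (adj x y ∧ allEqV eq xs ys) ∨ (eq x y ∧ productAdj adj eq xs ys)

Vertex : ℕ → ℕ → Set
Vertex m n = Vec (Fin 4 × Fin 4) m × Vec (Fin 4) n

dAdj : (m n : ℕ) → Vertex m n → Vertex m n → Bool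
dAdj m n (xs , us) (ys , vs) =
  (productAdj shrikhandeAdj eqS xs ys ∧ allEqV eqF us vs) ∨
  (allEqV eqS xs ys ∧ productAdj k4Adj eqF us vs)

allVec : {A : Set} → List A → (k : ℕ) → List (Vec A k)
allVec as zero = [] ∷ []
allVec as (suc k) = concatMap (λ a → map (a ∷_) (allVec as k)) as

allPairs : List (Fin 4 × Fin 4)
allPairs = concatMap (λ a → map (a ,_) (allFin 4)) (allFin 4)

allVertices : (m n : ℕ) → List (Vertex m n)
allVertices m n =
  concatMap (λ xs → map (xs ,_) (allVec (allFin 4) n)) (allVec allPairs m)

-- colours {1,2} encoded as Fin 2 (zero = colour 1, suc zero = colour 2)
eqC : Fin 2 → Fin 2 → Bool
eqC a b = ⌊ a ≟F b ⌋

nbrsOfColour : (m n : ℕ) → (Vertex m n → Fin 2) → Vertex m n → Fin 2 → ℕ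
nbrsOfColour m n col v i =
  length (filter (λ w → dAdj m n v w ∧ eqC (col w) i ≟ true) (allVertices m n))
  where open import Data.Bool.Properties using () renaming (_≟_ to _≟_)

colour1 colour2 : Fin 2
colour1 = zero
colour2 = suc zero

IsPerfectColouring : (m n : ℕ) → (b c : ℕ) → (Vertex m n → Fin 2) → Set
IsPerfectColouring m n b c col =
  ((i : Fin 2) → ∃[ v ] col v ≡ i) ×
  ((v : Vertex m n) → col v ≡ colour1 → nbrsOfColour m n col v colour2 ≡ b) ×
  ((v : Vertex m n) → col v ≡ colour2 → nbrsOfColour m n col v colour1 ≡ c) ×
  (∃[ k ] ((v : Vertex m n) → col v ≡ colour1 → nbrsOfColour m n col v colour1 ≡ k)) ×
  (∃[ k ] ((v : Vertex m n) → col v ≡ colour2 → nbrsOfColour m n col v colour2 ≡ k))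

PerfectColouring : (m n b c : ℕ) → Set
PerfectColouring m n b c = Σ (Vertex m n → Fin 2) (IsPerfectColouring m n b c)

-- Fix a vertex v of colour 1. Its neighbours fall into blocks, one per coordinate: six for each
-- Shrikhande coordinate and three for each K₄ coordinate. A colour-2 vertex w in a block has v as
-- its only colour-1 neighbour, so every vertex of the block adjacent to w has colour 2 as well.
-- The Shrikhande graph is locally a hexagon and K₄ locally a triangle, both connected, hence each
-- block is monochromatic and b is a sum of multiples of 6 and of 3 (only of 6 when n = 0).
module Submission where

open import Defs
open import Algebra.Properties.CommutativeSemigroup using (interchange)
open import Data.Bool using (Bool; true; false; _∧_; _∨_; if_then_else_)
open import Data.Bool.Properties using (∨-identityʳ) renaming (_≟_ to _≟ᵇ_)
open import Data.Fin using (Fin; zero; suc)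
open import Data.Fin.Properties using () renaming (_≟_ to _≟ᶠ_)
open import Data.List using (List; []; _∷_; _++_; map; concatMap; allFin; length; filter; filterᵇ)
open import Data.List.Membership.Propositional using (_∈_)
open import Data.List.Membership.Propositional.Properties using (∈-allFin; ∈-map⁺; ∈-concatMap⁺)
import Data.List.Membership.DecPropositional as DecMembership
open import Data.List.Relation.Unary.All using (all?)
import Data.List.Relation.Unary.All as All
open import Data.List.Relation.Unary.Any using (here; there)
import Data.List.Relation.Unary.Any as Any
open import Data.List.Relation.Unary.Linked using (Linked; _∷_; linked?)
open import Data.Nat using (ℕ; zero; suc; _+_; _*_; _≤_; z≤n; s≤s) renaming (_≟_ to _≟ⁿ_)
open import Data.Nat.Divisibility using (_∣_; divides; n∣m*n; _∣0; ∣m∣n⇒∣m+n; ∣-trans)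
open import Data.Nat.Properties
  using (+-assoc; +-identityʳ; *-suc; *-zeroʳ; +-mono-≤; ≤-refl; ≤-reflexive; ≤-trans; m≤m+n; m≤n+m;
         m+n≤o⇒m≤o; m+n≤o⇒n≤o; +-commutativeSemigroup; module ≤-Reasoning)
open import Data.Product using (_×_; _,_; ∃-syntax; proj₁; proj₂)
open import Data.Product.Properties using (≡-dec)
open import Data.Vec using (Vec; []; _∷_; lookup; _[_]≔_)
open import Data.Vec.Properties using ([]≔-lookup; []≔-idempotent; lookup∘update)
open import Relation.Binary.PropositionalEquality
open import Relation.Nullary using (contradiction)
open import Relation.Nullary.Decidable using (True; toWitness; _×-dec_; _→-dec_)
open import Relation.Unary using (Decidable)
open import Relation.Binary.Definitions using (DecidableEquality) renaming (Decidable to Decidable₂)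

𝟙 : Bool → ℕ
𝟙 b = if b then 1 else 0

sumOf : {A : Set} → (A → ℕ) → List A → ℕ
sumOf f []       = 0
sumOf f (x ∷ xs) = f x + sumOf f xs

module _ {A : Set} where

  sumOf-++ : (f : A → ℕ) (xs ys : List A) → sumOf f (xs ++ ys) ≡ sumOf f xs + sumOf f ys
  sumOf-++ f []       ys = refl
  sumOf-++ f (x ∷ xs) ys = trans (cong (f x +_) (sumOf-++ f xs ys)) (sym (+-assoc (f x) _ _))

  sumOf-cong : {f g : A → ℕ} → (∀ x → f x ≡ g x) → (xs : List A) → sumOf f xs ≡ sumOf g xs
  sumOf-cong f≡g []       = refl
  sumOf-cong f≡g (x ∷ xs) = cong₂ _+_ (f≡g x) (sumOf-cong f≡g xs)

  sumOf-mono-≤ : {f g : A → ℕ} → (∀ x → f x ≤ g x) → (xs : List A) → sumOf f xs ≤ sumOf g xs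
  sumOf-mono-≤ f≤g []       = z≤n
  sumOf-mono-≤ f≤g (x ∷ xs) = +-mono-≤ (f≤g x) (sumOf-mono-≤ f≤g xs)

  sumOf-+ : (f g : A → ℕ) (xs : List A) → sumOf (λ x → f x + g x) xs ≡ sumOf f xs + sumOf g xs
  sumOf-+ f g []       = refl
  sumOf-+ f g (x ∷ xs) =
    trans (cong (f x + g x +_) (sumOf-+ f g xs)) (interchange +-commutativeSemigroup (f x) (g x) _ _)

  sumOf-zero : (xs : List A) → sumOf (λ _ → 0) xs ≡ 0
  sumOf-zero []       = refl
  sumOf-zero (x ∷ xs) = sumOf-zero xs

  sumOf-if-const : (p : A → Bool) (f : A → ℕ) (k : ℕ) → (∀ x → p x ≡ true → f x ≡ k) →
    (xs : List A) → sumOf (λ x → if p x then f x else 0) xs ≡ k * sumOf (λ x → 𝟙 (p x)) xs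
  sumOf-if-const p f k const []       = sym (*-zeroʳ k)
  sumOf-if-const p f k const (x ∷ xs) with p x in px
  ... | true  = trans (cong₂ _+_ (const x px) (sumOf-if-const p f k const xs)) (sym (*-suc k _))
  ... | false = sumOf-if-const p f k const xs

  sumOf-if-∨ : (p q : Bool) (h₁ h₂ : A → Bool) (f : A → ℕ) (xs : List A) → (p ≡ true → q ≡ false) →
    sumOf (λ z → if (p ∧ h₁ z) ∨ (q ∧ h₂ z) then f z else 0) xs ≡
    (if p then sumOf (λ z → if h₁ z then f z else 0) xs else 0) +
    (if q then sumOf (λ z → if h₂ z then f z else 0) xs else 0)
  sumOf-if-∨ true  q h₁ h₂ f xs p⇒¬q rewrite p⇒¬q refl =
    trans (sumOf-cong (λ z → cong (λ c → if c then f z else 0) (∨-identityʳ (h₁ z))) xs)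
          (sym (+-identityʳ _))
  sumOf-if-∨ false true  h₁ h₂ f xs _ = refl
  sumOf-if-∨ false false h₁ h₂ f xs _ = sumOf-zero xs

  length-filter-∧ : (p q : A → Bool) (xs : List A) →
    length (filter (λ x → p x ∧ q x ≟ᵇ true) xs) ≡ sumOf (λ x → if p x then 𝟙 (q x) else 0) xs
  length-filter-∧ p q []       = refl
  length-filter-∧ p q (x ∷ xs) with p x | q x
  ... | true  | true  = cong suc (length-filter-∧ p q xs)
  ... | true  | false = length-filter-∧ p q xs
  ... | false | _     = length-filter-∧ p q xs

  linked-constant : {B : Set} {R : A → A → Set} (f : A → B) → (∀ {a a′} → R a a′ → f a ≡ f a′) →
    ∀ {h t} → Linked R (h ∷ t) → ∀ {y} → y ∈ h ∷ t → f y ≡ f h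
  linked-constant f step _             (here refl) = refl
  linked-constant f step (r ∷ linked) (there y∈t) = trans (linked-constant f step linked y∈t) (sym (step r))

module _ {A B C : Set} where

  sumOf-concatMap-map : (f : C → ℕ) (g : A → B → C) (as : List A) (bs : List B) →
    sumOf f (concatMap (λ a → map (g a) bs) as) ≡ sumOf (λ a → sumOf (λ b → f (g a b)) bs) as
  sumOf-concatMap-map f g []       bs = refl
  sumOf-concatMap-map f g (a ∷ as) bs =
    trans (sumOf-++ f (map (g a) bs) _) (cong₂ _+_ (sumOf-map bs) (sumOf-concatMap-map f g as bs))
    where
    sumOf-map : (bs : List B) → sumOf f (map (g a) bs) ≡ sumOf (λ b → f (g a b)) bs
    sumOf-map []       = refl
    sumOf-map (b ∷ bs) = cong (f (g a b) +_) (sumOf-map bs)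

module _ {A B : Set} (eqA : A → A → Bool) (eqB : B → B → Bool) (as : List A) (bs : List B)
  (eqA-δ : ∀ a (h : A → ℕ) → sumOf (λ a′ → if eqA a a′ then h a′ else 0) as ≡ h a)
  (eqB-δ : ∀ b (h : B → ℕ) → sumOf (λ b′ → if eqB b b′ then h b′ else 0) bs ≡ h b) where

  sumOf-δ² : ∀ a b (h : A → B → ℕ) →
    sumOf (λ a′ → sumOf (λ b′ → if eqA a a′ ∧ eqB b b′ then h a′ b′ else 0) bs) as ≡ h a b
  sumOf-δ² a b h = trans (sumOf-cong inner as) (eqA-δ a (λ a′ → h a′ b))
    where
    inner : ∀ a′ → sumOf (λ b′ → if eqA a a′ ∧ eqB b b′ then h a′ b′ else 0) bs ≡
                   (if eqA a a′ then h a′ b else 0)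
    inner a′ with eqA a a′
    ... | true  = eqB-δ b (h a′)
    ... | false = sumOf-zero bs

module Exhaustive {A : Set} {as : List A} (complete : ∀ x → x ∈ as) where

  decide-∀ : {P : A → Set} (P? : Decidable P) → {True (all? P? as)} → ∀ x → P x
  decide-∀ P? {ok} x = All.lookup (toWitness ok) (complete x)

  decide-∀₂ : {P : A → A → Set} (P? : ∀ x → Decidable (P x)) →
    {True (all? (λ x → all? (P? x) as) as)} → ∀ x y → P x y
  decide-∀₂ P? {ok} x y = All.lookup (All.lookup (toWitness ok) (complete x)) (complete y)

module ProductGraph {A : Set} (adj eq : A → A → Bool) (as : List A)
  (eq-δ : ∀ x (h : A → ℕ) → sumOf (λ y → if eq x y then h y else 0) as ≡ h x)
  (eq-sound : ∀ x y → eq x y ≡ true → x ≡ y)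
  (adj-irrefl : ∀ x → adj x x ≡ false) where

  adj⇒≢ : ∀ {x y} → adj x y ≡ true → x ≢ y
  adj⇒≢ {x} xy refl with () ← trans (sym xy) (adj-irrefl x)

  adj⇒¬eq : ∀ x y → adj x y ≡ true → eq x y ≡ false
  adj⇒¬eq x y xy with eq x y in e
  ... | false = refl
  ... | true  = contradiction (eq-sound x y e) (adj⇒≢ xy)

  allEqV-δ : ∀ {k} (xs : Vec A k) (g : Vec A k → ℕ) →
    sumOf (λ ys → if allEqV eq xs ys then g ys else 0) (allVec as k) ≡ g xs
  allEqV-δ []               g = +-identityʳ (g [])
  allEqV-δ {suc k} (x ∷ xs) g =
    trans (sumOf-concatMap-map _ _∷_ as (allVec as k))
          (sumOf-δ² eq (allEqV eq) as (allVec as k) eq-δ allEqV-δ x xs (λ a ys → g (a ∷ ys)))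

  productAdj⇒¬allEqV : ∀ {k} (xs ys : Vec A k) → productAdj adj eq xs ys ≡ true → allEqV eq xs ys ≡ false
  productAdj⇒¬allEqV []       []       ()
  productAdj⇒¬allEqV (x ∷ xs) (y ∷ ys) xy with adj x y in e₁ | eq x y in e₂
  ... | true  | true  with () ← trans (sym (adj⇒¬eq x y e₁)) e₂
  ... | true  | false = refl
  ... | false | true  = productAdj⇒¬allEqV xs ys xy
  ... | false | false with () ← xy

  neighbourhoodSum : A → (A → ℕ) → ℕ
  neighbourhoodSum x ψ = sumOf (λ c → if adj x c then ψ c else 0) as

  coordinateSum : ∀ {k} → Vec A k → Fin k → (Vec A k → ℕ) → ℕ
  coordinateSum xs i g = neighbourhoodSum (lookup xs i) (λ a → g (xs [ i ]≔ a))

  neighbourSum : ∀ {k} → Vec A k → (Vec A k → ℕ) → ℕ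
  neighbourSum []       g = 0
  neighbourSum (x ∷ xs) g = coordinateSum (x ∷ xs) zero g + neighbourSum xs (λ ys → g (x ∷ ys))

  productAdj-sum : ∀ {k} (xs : Vec A k) (g : Vec A k → ℕ) →
    sumOf (λ ys → if productAdj adj eq xs ys then g ys else 0) (allVec as k) ≡ neighbourSum xs g
  productAdj-sum []               g = refl
  productAdj-sum {suc k} (x ∷ xs) g = begin
      sumOf F (allVec as (suc k))
        ≡⟨ sumOf-concatMap-map F _∷_ as (allVec as k) ⟩
      sumOf (λ a → sumOf (λ ys → F (a ∷ ys)) (allVec as k)) as
        ≡⟨ sumOf-cong (λ a → sumOf-if-∨ (adj x a) (eq x a) (allEqV eq xs) (productAdj adj eq xs)
                                        (λ ys → g (a ∷ ys)) (allVec as k) (adj⇒¬eq x a)) as ⟩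
      sumOf (λ a → (if adj x a then along a else 0) + (if eq x a then across a else 0)) as
        ≡⟨ sumOf-+ _ _ as ⟩
      sumOf (λ a → if adj x a then along a else 0) as + sumOf (λ a → if eq x a then across a else 0) as
        ≡⟨ cong₂ _+_ (sumOf-cong (λ a → cong (λ s → if adj x a then s else 0) (allEqV-δ xs (λ ys → g (a ∷ ys)))) as)
                     (eq-δ x across) ⟩
      coordinateSum (x ∷ xs) zero g + across x
        ≡⟨ cong (coordinateSum (x ∷ xs) zero g +_) (productAdj-sum xs (λ ys → g (x ∷ ys))) ⟩
      neighbourSum (x ∷ xs) g ∎
    where
    open ≡-Reasoning
    F : Vec A (suc k) → ℕ
    F ys = if productAdj adj eq (x ∷ xs) ys then g ys else 0
    along across : A → ℕ
    along  a = sumOf (λ ys → if allEqV eq xs ys then g (a ∷ ys) else 0) (allVec as k)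
    across a = sumOf (λ ys → if productAdj adj eq xs ys then g (a ∷ ys) else 0) (allVec as k)

  coordinateSum≤neighbourSum : ∀ {k} (xs : Vec A k) i (g : Vec A k → ℕ) → coordinateSum xs i g ≤ neighbourSum xs g
  coordinateSum≤neighbourSum (x ∷ xs) zero    g = m≤m+n _ _
  coordinateSum≤neighbourSum (x ∷ xs) (suc i) g =
    ≤-trans (coordinateSum≤neighbourSum xs i (λ ys → g (x ∷ ys))) (m≤n+m _ _)

  coordinateSum-update : ∀ {k} (xs : Vec A k) i a (g : Vec A k → ℕ) →
    coordinateSum (xs [ i ]≔ a) i g ≡ neighbourhoodSum a (λ c → g (xs [ i ]≔ c))
  coordinateSum-update xs i a g rewrite lookup∘update i xs a =
    sumOf-cong (λ c → cong (λ ys → if adj a c then g ys else 0) ([]≔-idempotent xs i)) as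

  neighbourSum-divisible : ∀ d {k} (xs : Vec A k) (g : Vec A k → ℕ) →
    (∀ i → d ∣ coordinateSum xs i g) → d ∣ neighbourSum xs g
  neighbourSum-divisible d []       g _ = d ∣0
  neighbourSum-divisible d (x ∷ xs) g d∣ =
    ∣m∣n⇒∣m+n (d∣ zero) (neighbourSum-divisible d xs (λ ys → g (x ∷ ys)) (λ i → d∣ (suc i)))

  neighbourSum-[] : ∀ {k} (xs : Vec A k) (g : Vec A k → ℕ) → k ≡ 0 → neighbourSum xs g ≡ 0
  neighbourSum-[] [] g refl = refl

  pair≤neighbourhoodSum : ∀ {a x x′} (ψ : A → ℕ) → adj a x ≡ true → adj a x′ ≡ true → x ≢ x′ →
    ψ x + ψ x′ ≤ neighbourhoodSum a ψ
  pair≤neighbourhoodSum {a} {x} {x′} ψ ax ax′ x≢x′ = begin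
      ψ x + ψ x′
        ≡⟨ sym (cong₂ _+_ (eq-δ x ψ) (eq-δ x′ ψ)) ⟩
      sumOf (λ c → if eq x c then ψ c else 0) as + sumOf (λ c → if eq x′ c then ψ c else 0) as
        ≡⟨ sym (sumOf-+ _ _ as) ⟩
      sumOf (λ c → (if eq x c then ψ c else 0) + (if eq x′ c then ψ c else 0)) as
        ≤⟨ sumOf-mono-≤ pointwise as ⟩
      neighbourhoodSum a ψ ∎
    where
    open ≤-Reasoning
    pointwise : ∀ c → (if eq x c then ψ c else 0) + (if eq x′ c then ψ c else 0) ≤ (if adj a c then ψ c else 0)
    pointwise c with eq x c in e | eq x′ c in e′
    ... | true  | true  = contradiction (trans (eq-sound x c e) (sym (eq-sound x′ c e′))) x≢x′
    ... | true  | false rewrite eq-sound x c e | ax = ≤-reflexive (+-identityʳ _)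
    ... | false | true  rewrite eq-sound x′ c e′ | ax′ = ≤-refl
    ... | false | false = z≤n

  LocalEdge : A → A → A → Set
  LocalEdge x a a′ = adj x a ≡ true × adj x a′ ≡ true × adj a a′ ≡ true

  localEdge? : ∀ x → Decidable₂ (LocalEdge x)
  localEdge? x a a′ = (adj x a ≟ᵇ true) ×-dec (adj x a′ ≟ᵇ true) ×-dec (adj a a′ ≟ᵇ true)

  -- χ is the colouring along one coordinate line of the product, through a colour-1 vertex sitting at x.
  module LocalColouring (adj-sym : ∀ x y → adj x y ≡ adj y x)
    (hub : A → List A) (hub-linked : ∀ x → Linked (LocalEdge x) (hub x))
    (hub-covers : ∀ x y → adj x y ≡ true → y ∈ hub x)
    (d : ℕ) (regular : ∀ x → sumOf (λ y → 𝟙 (adj x y)) as ≡ d)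
    (χ : A → Fin 2) (x : A) (χx : χ x ≡ colour1)
    (colour₁-unique : ∀ a → adj x a ≡ true → χ a ≡ colour2 →
                      neighbourhoodSum a (λ c → 𝟙 (eqC (χ c) colour1)) ≤ 1)
    where

    colour₂-spreads : ∀ {a a′} → LocalEdge x a a′ → χ a ≡ colour2 → χ a′ ≡ colour2
    colour₂-spreads {a} {a′} (xa , xa′ , aa′) χa with χ a′ in χa′
    ... | suc zero = refl
    ... | zero     = contradiction (≤-trans two≤ (colour₁-unique a xa χa)) λ { (s≤s ()) }
      where
      two≤ : 2 ≤ neighbourhoodSum a (λ c → 𝟙 (eqC (χ c) colour1))
      two≤ = subst₂ (λ c c′ → 𝟙 (eqC c colour1) + 𝟙 (eqC c′ colour1) ≤
                              neighbourhoodSum a (λ c → 𝟙 (eqC (χ c) colour1)))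
                    χx χa′ (pair≤neighbourhoodSum _ (trans (adj-sym a x) xa) aa′ (adj⇒≢ xa′))

    local-edge-colour : ∀ {a a′} → LocalEdge x a a′ → χ a ≡ χ a′
    local-edge-colour {a} {a′} e@(xa , xa′ , aa′) with χ a in χa | χ a′ in χa′
    ... | zero     | zero     = refl
    ... | suc zero | suc zero = refl
    ... | suc zero | zero     with () ← trans (sym χa′) (colour₂-spreads e χa)
    ... | zero     | suc zero with () ← trans (sym χa) (colour₂-spreads (xa′ , xa , trans (adj-sym a′ a) aa′) χa′)

    neighbours-monochromatic : ∃[ c ] (∀ y → adj x y ≡ true → χ y ≡ c)
    neighbours-monochromatic with hub x | hub-linked x | hub-covers x
    ... | []    | _      | covers = colour1 , λ y xy → contradiction (covers y xy) λ ()
    ... | h ∷ _ | linked | covers = χ h , λ y xy → linked-constant χ local-edge-colour linked (covers y xy)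

    colour₂-neighbours-divisible : d ∣ neighbourhoodSum x (λ c → 𝟙 (eqC (χ c) colour2))
    colour₂-neighbours-divisible with c , mono ← neighbours-monochromatic =
      subst (d ∣_) (sym (trans (sumOf-if-const (adj x) _ k (λ y xy → cong (λ c → 𝟙 (eqC c colour2)) (mono y xy)) as)
                               (cong (k *_) (regular x))))
            (n∣m*n k)
      where
      k : ℕ
      k = 𝟙 (eqC c colour2)

eqF-δ : ∀ x (h : Fin 4 → ℕ) → sumOf (λ y → if eqF x y then h y else 0) (allFin 4) ≡ h x
eqF-δ zero                   h = +-identityʳ _
eqF-δ (suc zero)             h = +-identityʳ _
eqF-δ (suc (suc zero))       h = +-identityʳ _
eqF-δ (suc (suc (suc zero))) h = +-identityʳ _

module K₄ where
  open Exhaustive (∈-allFin {4})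

  eq-sound : ∀ x y → eqF x y ≡ true → x ≡ y
  eq-sound = decide-∀₂ (λ x y → (eqF x y ≟ᵇ true) →-dec (x ≟ᶠ y))

  irrefl : ∀ x → k4Adj x x ≡ false
  irrefl = decide-∀ (λ x → k4Adj x x ≟ᵇ false)

  sym-adj : ∀ x y → k4Adj x y ≡ k4Adj y x
  sym-adj = decide-∀₂ (λ x y → k4Adj x y ≟ᵇ k4Adj y x)

  regular : ∀ x → sumOf (λ y → 𝟙 (k4Adj x y)) (allFin 4) ≡ 3
  regular = decide-∀ (λ x → sumOf (λ y → 𝟙 (k4Adj x y)) (allFin 4) ≟ⁿ 3)

  others : Fin 4 → List (Fin 4)
  others x = filterᵇ (k4Adj x) (allFin 4)

  open ProductGraph k4Adj eqF (allFin 4) eqF-δ eq-sound irrefl public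

  others-linked : ∀ x → Linked (LocalEdge x) (others x)
  others-linked = decide-∀ {P = λ x → Linked (LocalEdge x) (others x)}
    (λ x → linked? (localEdge? x) (others x))

  others-covers : ∀ x y → k4Adj x y ≡ true → y ∈ others x
  others-covers = decide-∀₂ {P = λ x y → k4Adj x y ≡ true → y ∈ others x}
    (λ x y → (k4Adj x y ≟ᵇ true) →-dec (y ∈? others x))
    where open DecMembership (_≟ᶠ_ {4}) using (_∈?_)

  open LocalColouring sym-adj others others-linked others-covers 3 regular public

Z₄² : Set
Z₄² = Fin 4 × Fin 4

_≟ᶻ_ : DecidableEquality Z₄²
_≟ᶻ_ = ≡-dec _≟ᶠ_ _≟ᶠ_

∈-allPairs : ∀ x → x ∈ allPairs
∈-allPairs (a , b) =
  ∈-concatMap⁺ (λ a′ → map (a′ ,_) (allFin 4)) (Any.map (λ { refl → ∈-map⁺ (a ,_) (∈-allFin b) }) (∈-allFin a))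

module Shrikhande where
  open Exhaustive ∈-allPairs
  open DecMembership _≟ᶻ_ using (_∈?_)

  eq-δ : ∀ x (h : Z₄² → ℕ) → sumOf (λ y → if eqS x y then h y else 0) allPairs ≡ h x
  eq-δ (a , b) h = trans (sumOf-concatMap-map (λ y → if eqS (a , b) y then h y else 0) _,_ (allFin 4) (allFin 4))
                         (sumOf-δ² eqF eqF (allFin 4) (allFin 4) eqF-δ eqF-δ a b (λ c d → h (c , d)))

  eq-sound : ∀ x y → eqS x y ≡ true → x ≡ y
  eq-sound = decide-∀₂ (λ x y → (eqS x y ≟ᵇ true) →-dec (x ≟ᶻ y))

  irrefl : ∀ x → shrikhandeAdj x x ≡ false
  irrefl = decide-∀ (λ x → shrikhandeAdj x x ≟ᵇ false)

  sym-adj : ∀ x y → shrikhandeAdj x y ≡ shrikhandeAdj y x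
  sym-adj = decide-∀₂ (λ x y → shrikhandeAdj x y ≟ᵇ shrikhandeAdj y x)

  regular : ∀ x → sumOf (λ y → 𝟙 (shrikhandeAdj x y)) allPairs ≡ 6
  regular = decide-∀ (λ x → sumOf (λ y → 𝟙 (shrikhandeAdj x y)) allPairs ≟ⁿ 6)

  -- x + 01, x + 11, x + 10, x + 03, x + 33, x + 30: the neighbours of x in the cyclic order of the hexagon they span
  hexagon : Z₄² → List Z₄²
  hexagon (a , b) =
    (a , suc4 b) ∷ (suc4 a , suc4 b) ∷ (suc4 a , b) ∷ (a , pred4 b) ∷ (pred4 a , pred4 b) ∷ (pred4 a , b) ∷ []

  open ProductGraph shrikhandeAdj eqS allPairs eq-δ eq-sound irrefl public

  hexagon-linked : ∀ x → Linked (LocalEdge x) (hexagon x)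
  hexagon-linked = decide-∀ {P = λ x → Linked (LocalEdge x) (hexagon x)}
    (λ x → linked? (localEdge? x) (hexagon x))

  hexagon-covers : ∀ x y → shrikhandeAdj x y ≡ true → y ∈ hexagon x
  hexagon-covers = decide-∀₂ {P = λ x y → shrikhandeAdj x y ≡ true → y ∈ hexagon x}
    (λ x y → (shrikhandeAdj x y ≟ᵇ true) →-dec (y ∈? hexagon x))

  open LocalColouring sym-adj hexagon hexagon-linked hexagon-covers 6 regular public

dAdj-sum : ∀ m n (xs : Vec Z₄² m) (us : Vec (Fin 4) n) (g : Vertex m n → ℕ) →
  sumOf (λ w → if dAdj m n (xs , us) w then g w else 0) (allVertices m n) ≡
  Shrikhande.neighbourSum xs (λ ys → g (ys , us)) + K₄.neighbourSum us (λ vs → g (xs , vs))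
dAdj-sum m n xs us g = begin
    sumOf F (allVertices m n)
      ≡⟨ sumOf-concatMap-map F _,_ (allVec allPairs m) (allVec (allFin 4) n) ⟩
    sumOf (λ ys → sumOf (λ vs → F (ys , vs)) (allVec (allFin 4) n)) (allVec allPairs m)
      ≡⟨ sumOf-cong (λ ys → sumOf-if-∨ (shrikhandeStep ys) (shrikhandeStill ys) (allEqV eqF us)
                                       (productAdj k4Adj eqF us) (λ vs → g (ys , vs)) (allVec (allFin 4) n)
                                       (Shrikhande.productAdj⇒¬allEqV xs ys)) (allVec allPairs m) ⟩
    sumOf (λ ys → (if shrikhandeStep ys then k₄Still ys else 0) + (if shrikhandeStill ys then k₄Step ys else 0))
          (allVec allPairs m)
      ≡⟨ sumOf-+ _ _ (allVec allPairs m) ⟩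
    sumOf (λ ys → if shrikhandeStep ys then k₄Still ys else 0) (allVec allPairs m) +
    sumOf (λ ys → if shrikhandeStill ys then k₄Step ys else 0) (allVec allPairs m)
      ≡⟨ cong₂ _+_
           (trans (sumOf-cong (λ ys → cong (λ s → if shrikhandeStep ys then s else 0)
                                           (K₄.allEqV-δ us (λ vs → g (ys , vs)))) (allVec allPairs m))
                  (Shrikhande.productAdj-sum xs (λ ys → g (ys , us))))
           (trans (sumOf-cong (λ ys → cong (λ s → if shrikhandeStill ys then s else 0)
                                           (K₄.productAdj-sum us (λ vs → g (ys , vs)))) (allVec allPairs m))
                  (Shrikhande.allEqV-δ xs (λ ys → K₄.neighbourSum us (λ vs → g (ys , vs))))) ⟩
    Shrikhande.neighbourSum xs (λ ys → g (ys , us)) + K₄.neighbourSum us (λ vs → g (xs , vs)) ∎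
  where
  open ≡-Reasoning
  F : Vertex m n → ℕ
  F w = if dAdj m n (xs , us) w then g w else 0
  shrikhandeStep shrikhandeStill : Vec Z₄² m → Bool
  shrikhandeStep  ys = productAdj shrikhandeAdj eqS xs ys
  shrikhandeStill ys = allEqV eqS xs ys
  k₄Step k₄Still : Vec Z₄² m → ℕ
  k₄Still ys = sumOf (λ vs → if allEqV eqF us vs then g (ys , vs) else 0) (allVec (allFin 4) n)
  k₄Step  ys = sumOf (λ vs → if productAdj k4Adj eqF us vs then g (ys , vs) else 0) (allVec (allFin 4) n)

module _ {m n : ℕ} (col : Vertex m n → Fin 2) where

  inColour : Fin 2 → Vertex m n → ℕ
  inColour i w = 𝟙 (eqC (col w) i)

  nbrsOfColour-split : ∀ xs us i → nbrsOfColour m n col (xs , us) i ≡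
    Shrikhande.neighbourSum xs (λ ys → inColour i (ys , us)) + K₄.neighbourSum us (λ vs → inColour i (xs , vs))
  nbrsOfColour-split xs us i =
    trans (length-filter-∧ (dAdj m n (xs , us)) (λ w → eqC (col w) i) (allVertices m n))
          (dAdj-sum m n xs us (inColour i))

  module _ (colour₂-sees-one : ∀ v → col v ≡ colour2 → nbrsOfColour m n col v colour1 ≡ 1) where

    colour₁-neighbours-split : ∀ xs us → col (xs , us) ≡ colour2 →
      Shrikhande.neighbourSum xs (λ ys → inColour colour1 (ys , us)) ≤ 1 ×
      K₄.neighbourSum us (λ vs → inColour colour1 (xs , vs)) ≤ 1
    colour₁-neighbours-split xs us c₂ = m+n≤o⇒m≤o _ sum≤1 , m+n≤o⇒n≤o _ sum≤1
      where
      sum≤1 : Shrikhande.neighbourSum xs (λ ys → inColour colour1 (ys , us)) +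
              K₄.neighbourSum us (λ vs → inColour colour1 (xs , vs)) ≤ 1
      sum≤1 = ≤-reflexive (trans (sym (nbrsOfColour-split xs us colour1)) (colour₂-sees-one _ c₂))

    module _ {xs us} (v₁ : col (xs , us) ≡ colour1) where

      shrikhande-part-divisible : 6 ∣ Shrikhande.neighbourSum xs (λ ys → inColour colour2 (ys , us))
      shrikhande-part-divisible = Shrikhande.neighbourSum-divisible 6 xs _ λ i →
        Shrikhande.colour₂-neighbours-divisible (λ c → col (xs [ i ]≔ c , us)) (lookup xs i)
          (trans (cong (λ ys → col (ys , us)) ([]≔-lookup xs i)) v₁)
          λ a _ c₂ → subst (_≤ 1) (Shrikhande.coordinateSum-update xs i a (λ ys → inColour colour1 (ys , us)))
                       (≤-trans (Shrikhande.coordinateSum≤neighbourSum (xs [ i ]≔ a) i _)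
                                (proj₁ (colour₁-neighbours-split (xs [ i ]≔ a) us c₂)))

      k₄-part-divisible : 3 ∣ K₄.neighbourSum us (λ vs → inColour colour2 (xs , vs))
      k₄-part-divisible = K₄.neighbourSum-divisible 3 us _ λ i →
        K₄.colour₂-neighbours-divisible (λ c → col (xs , us [ i ]≔ c)) (lookup us i)
          (trans (cong (λ vs → col (xs , vs)) ([]≔-lookup us i)) v₁)
          λ a _ c₂ → subst (_≤ 1) (K₄.coordinateSum-update us i a (λ vs → inColour colour1 (xs , vs)))
                       (≤-trans (K₄.coordinateSum≤neighbourSum (us [ i ]≔ a) i _)
                                (proj₂ (colour₁-neighbours-split xs (us [ i ]≔ a) c₂)))

proposition2 : (m n b : ℕ) → 1 ≤ b → PerfectColouring m n b 1 →
    (3 ∣ b) × (n ≡ 0 → 6 ∣ b)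
proposition2 m n b _ (col , surjective , colour₁-sees-b , colour₂-sees-one , _)
  with (xs , us) , v₁ ← surjective colour1 =
    subst (3 ∣_) b≡ (∣m∣n⇒∣m+n (∣-trans (divides 2 refl) shrikhande-part) k₄-part) ,
    λ n≡0 → subst (6 ∣_) b≡ (∣m∣n⇒∣m+n shrikhande-part
                               (subst (6 ∣_) (sym (K₄.neighbourSum-[] us _ n≡0)) (6 ∣0)))
  where
  shrikhande-part : 6 ∣ Shrikhande.neighbourSum xs (λ ys → inColour col colour2 (ys , us))
  shrikhande-part = shrikhande-part-divisible col colour₂-sees-one v₁
  k₄-part : 3 ∣ K₄.neighbourSum us (λ vs → inColour col colour2 (xs , vs))
  k₄-part = k₄-part-divisible col colour₂-sees-one v₁
  b≡ : Shrikhande.neighbourSum xs (λ ys → inColour col colour2 (ys , us)) +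
       K₄.neighbourSum us (λ vs → inColour col colour2 (xs , vs)) ≡ b
  b≡ = trans (sym (nbrsOfColour-split col xs us colour2)) (colour₁-sees-b _ v₁)
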